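{- Let $G$ be a connected graph on $n$ vertices such that $\chi_G(u,u) = \chi_G(v,v)$ for all $u,v \in V(G)$ and $\{w_1,w_2\}$ is a $2$-separator of $G$. Let $C$ be the vertex set of a connected component of $G - \{w_1,w_2\}$ with $|C| < \frac{n}{2}$, and let $v \in C$. Then there is no vertex $u \in N(v)$ such that $\mathrm{dist}(u,w_1) < \mathrm{dist}(v,w_1)$ and $\mathrm{dist}(u,w_2) < \mathrm{dist}(v,w_2)$.
   Context: All graphs are finite, simple and undirected; $N(v)$ is the neighborhood, $\mathrm{dist}$ the graph distance. A 2-separator is a set $S$ of two vertices such that $G-S$ has more connected components than $G$. The 2-dimensional Weisfeiler-Leman algorithm: $\chi^0(v_1,v_2)=\chi^0(w_1,w_2)$ iff ($v_1=v_2 \Leftrightarrow w_1=w_2$) and ($v_1v_2\in E\Leftrightarrow w_1w_2\in E$); $\chi^{r+1}(v_1,v_2) = \big(\chi^r(v_1,v_2), \{\!\{(\chi^r(w,v_2),\chi^r(v_1,w)) \mid w \in V(G)\}\!\}\big)$; $\chi_G$ is the stable coloring, i.e. $\chi^r$ for the minimal $r$ such that $\chi^{r+1}$ induces no strictly finer partition than $\chi^r$. -}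

module Defs where

open import Data.Nat using (ℕ; zero; suc; _<_; _*_)
open import Data.Bool using (Bool; true; false)
open import Data.Fin using (Fin)
open import Data.Fin.Subset using (Subset; _∈_; _∉_; ∣_∣)
open import Data.Fin.Permutation using (Permutation′; _⟨$⟩ʳ_)
open import Data.Product using (Σ; _×_; _,_; ∃)
open import Data.Unit using (⊤)
open import Relation.Nullary using (¬_)
open import Relation.Binary.PropositionalEquality using (_≡_; _≢_)
open import Function.Bundles using (_⇔_)
open import Data.Sum using (_⊎_)

record Graph (n : ℕ) : Set where
  field
    E      : Fin n → Fin n → Bool
    sym    : ∀ x y → E x y ≡ E y x
    irrefl : ∀ x → E x x ≡ false

module _ {n : ℕ} (G : Graph n) where
  open Graph G

  Adj : Fin n → Fin n → Set
  Adj x y = E x y ≡ true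

  -- walks all of whose vertices satisfy P (i.e. walks in the induced subgraph G[P])
  data PathIn (P : Fin n → Set) : Fin n → Fin n → Set where
    here : ∀ {x} → P x → PathIn P x x
    step : ∀ {x y z} → P x → Adj x y → PathIn P y z → PathIn P x z

  -- G[P] has exactly k connected components: a surjective labelling of the
  -- vertices of G[P] by Fin k whose fibres are exactly the components.
  NumComponents : (Fin n → Set) → ℕ → Set
  NumComponents P k =
    Σ ((x : Fin n) → P x → Fin k) λ c →
      (∀ i → Σ (Fin n) λ x → Σ (P x) λ px → c x px ≡ i) ×
      (∀ x y (px : P x) (py : P y) → (c x px ≡ c y py) ⇔ PathIn P x y)

  Outside : Subset n → Fin n → Set
  Outside S x = x ∉ S

  Connected : Set
  Connected = ∀ x y → PathIn (λ _ → ⊤) x y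

  IsSeparator : Subset n → Set
  IsSeparator S = Σ ℕ λ k → Σ ℕ λ k′ →
    NumComponents (λ _ → ⊤) k × NumComponents (Outside S) k′ × k < k′

  Is2Separator : Fin n → Fin n → Set
  Is2Separator w₁ w₂ = w₁ ≢ w₂ ×
    Σ (Subset n) λ S → (∀ x → (x ∈ S) ⇔ ((x ≡ w₁) ⊎ (x ≡ w₂))) × IsSeparator S

  IsComponentOf : Subset n → Subset n → Set
  IsComponentOf S C =
    (Σ (Fin n) λ x → x ∈ C) ×
    (∀ x → x ∈ C → x ∉ S) ×
    (∀ x y → x ∈ C → y ∈ C → PathIn (Outside S) x y) ×
    (∀ x y → x ∈ C → PathIn (Outside S) x y → y ∈ C)

  data Walk : ℕ → Fin n → Fin n → Set where
    nil  : ∀ {x} → Walk zero x x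
    cons : ∀ {ℓ x y z} → Adj x y → Walk ℓ y z → Walk (suc ℓ) x z

  Dist : Fin n → Fin n → ℕ → Set
  Dist x y d = Walk d x y × (∀ ℓ → ℓ < d → ¬ Walk ℓ x y)

  -- 2-dimensional Weisfeiler-Leman: "χ^r(p) = χ^r(q)" as a relation on pairs.
  -- Equality of the multisets {{(χ^r(w,v₂), χ^r(v₁,w)) | w}} is expressed by a
  -- permutation π of V(G) matching the pairs.
  Pair : Set
  Pair = Fin n × Fin n

  SameColour : ℕ → Pair → Pair → Set
  SameColour zero (v₁ , v₂) (w₁ , w₂) =
    ((v₁ ≡ v₂) ⇔ (w₁ ≡ w₂)) × (E v₁ v₂ ≡ E w₁ w₂)
  SameColour (suc r) (v₁ , v₂) (w₁ , w₂) =
    SameColour r (v₁ , v₂) (w₁ , w₂) ×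
    Σ (Permutation′ n) λ π → ∀ w →
      SameColour r (w , v₂) (π ⟨$⟩ʳ w , w₂) ×
      SameColour r (v₁ , w) (w₁ , π ⟨$⟩ʳ w)

  NotFiner : ℕ → Set
  NotFiner r = ∀ p q → SameColour r p q → SameColour (suc r) p q

  StableRound : ℕ → Set
  StableRound r = NotFiner r × (∀ r′ → r′ < r → ¬ NotFiner r′)

  StableSameColour : Pair → Pair → Set
  StableSameColour p q = Σ ℕ λ r → StableRound r × SameColour r p q

module Submission where

-- Let R be the stable round of 2-WL on G, and let v ~ u be an
-- edge.  For a pair (y , z) write nearer y z for the number of vertices x with
-- dist x y < dist x z.  The argument has three parts.
--   * Balance (the heart): if all diagonal pairs share a stable colour, then
--     nearer u v = nearer v u.  Let K be the stable colour class of (v , u).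
--     Every vertex has the same in- and out-degree in K, so for every x the sums
--     of dist x y and of dist x z over the arcs (y , z) of K agree; since the
--     two endpoints of an arc are adjacent, this forces the number of arcs of K
--     whose source is nearer to x to equal the number whose target is.  Summing
--     over x and using that nearer is a colour invariant gives
--     |K| * nearer v u = |K| * nearer u v.
--   * Separation: every walk leaving the component C crosses S = {w₁ , w₂}, so
--     if u is closer than v to both w₁ and w₂, then u is closer than v to every
--     vertex outside C.
--   * Counting: the two parts give n - |C| ≤ nearer u v ≤ n / 2, which
--     contradicts 2 |C| < n.

open import Defs
open import Data.Bool using (true; false)
import Data.Bool.Properties as Bool
open import Data.Empty using (⊥-elim)
open import Data.Fin using (Fin; zero; suc; punchIn)
open import Data.Fin.Properties using (any?) renaming (_≟_ to _≟ᶠ_)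
open import Data.Fin.Permutation as Perm using (Permutation; _⟨$⟩ʳ_; _⟨$⟩ˡ_; _∘ₚ_)
open import Data.Fin.Subset using (Subset; _∈_; _∉_; ∣_∣)
open import Data.Fin.Subset.Properties using (_∈?_; drop-there)
open import Data.Nat using (ℕ; zero; suc; _+_; _*_; _<_; _≤_; z≤n; s≤s; _<?_; >-nonZero)
open import Data.Nat.Properties
open import Data.Nat.Tactic.RingSolver using (solve-∀)
open import Data.Product using (Σ; _×_; _,_; proj₁; proj₂)
open import Data.Sum using (_⊎_; inj₁; inj₂)
open import Data.Vec using (_∷_; [])
open import Data.Vec.Base using (there)
open import Function using (_∘_)
open import Function.Bundles using (_⇔_; mk⇔; Equivalence)
open import Relation.Binary using (tri<; tri≈; tri>)
open import Relation.Binary.PropositionalEquality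
open import Relation.Nullary using (¬_; Dec; yes; no)
open import Relation.Nullary.Decidable using (_×-dec_)
open import Algebra.Properties.Semiring.Sum +-*-semiring
  using (sum; sum-cong-≗; ∑-comm; ∑-distrib-+; sum-permute; sum-remove; *-distribˡ-sum; *-distribʳ-sum)

𝟙 : {A : Set} → Dec A → ℕ
𝟙 (yes _) = 1
𝟙 (no _)  = 0

𝟙-cong : {A B : Set} → (A → B) → (B → A) → (a : Dec A) (b : Dec B) → 𝟙 a ≡ 𝟙 b
𝟙-cong f g (yes _) (yes _) = refl
𝟙-cong f g (yes x) (no ¬y) = ⊥-elim (¬y (f x))
𝟙-cong f g (no ¬x) (yes y) = ⊥-elim (¬x (g y))
𝟙-cong f g (no _)  (no _)  = refl

𝟙-true : {A : Set} (a : Dec A) → A → 𝟙 a ≡ 1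
𝟙-true (yes _) _ = refl
𝟙-true (no ¬x) x = ⊥-elim (¬x x)

𝟙-*-cong : {A : Set} (a : Dec A) {x y : ℕ} → (A → x ≡ y) → 𝟙 a * x ≡ 𝟙 a * y
𝟙-*-cong (yes p) x≡y = cong (1 *_) (x≡y p)
𝟙-*-cong (no _)  _   = refl

𝟙<-exclusive : ∀ a b → 𝟙 (a <? b) + 𝟙 (b <? a) ≤ 1
𝟙<-exclusive a b with a <? b | b <? a
... | yes a<b | yes b<a = ⊥-elim (<-asym a<b b<a)
... | yes _   | no _    = ≤-refl
... | no _    | yes _   = ≤-refl
... | no _    | no _    = z≤n

𝟙<-level : ∀ a b → a ≤ suc b → b ≤ suc a → a + 𝟙 (a <? b) ≡ b + 𝟙 (b <? a)
𝟙<-level a b a≤1+b b≤1+a with a <? b | b <? a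
... | yes a<b | yes b<a = ⊥-elim (<-asym a<b b<a)
... | yes a<b | no _    = trans (+-comm a 1) (trans (≤-antisym a<b b≤1+a) (sym (+-identityʳ b)))
... | no _    | yes b<a = trans (+-identityʳ a) (trans (sym (≤-antisym b<a a≤1+b)) (+-comm 1 b))
... | no a≮b  | no b≮a  = cong (_+ 0) (≤-antisym (≮⇒≥ b≮a) (≮⇒≥ a≮b))

sum-const : ∀ m k → sum {m} (λ _ → k) ≡ m * k
sum-const zero    k = refl
sum-const (suc m) k = cong (k +_) (sum-const m k)

sum-mono : ∀ {m} {f g : Fin m → ℕ} → (∀ i → f i ≤ g i) → sum f ≤ sum g
sum-mono {zero}  _   = z≤n
sum-mono {suc m} f≤g = +-mono-≤ (f≤g zero) (sum-mono (f≤g ∘ suc))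

term≤sum : ∀ {m} (f : Fin m → ℕ) i → f i ≤ sum f
term≤sum {suc m} f i = ≤-trans (m≤m+n (f i) _) (≤-reflexive (sym (sum-remove {i = i} f)))

∣∣-count : ∀ {m} (C : Subset m) → ∣ C ∣ ≡ sum (λ x → 𝟙 (x ∈? C))
∣∣-count []          = refl
∣∣-count (true ∷ C)  = cong suc (trans (∣∣-count C) (sum-cong-≗ (λ x → 𝟙-cong there drop-there (x ∈? C) _)))
∣∣-count (false ∷ C) = trans (∣∣-count C) (sum-cong-≗ (λ x → 𝟙-cong there drop-there (x ∈? C) _))

least-witness : (P : ℕ → Set) → (∀ k → Dec (P k)) → ∀ L → P L →
                Σ ℕ λ d → P d × (∀ ℓ → ℓ < d → ¬ P ℓ)
least-witness P P? zero    pL = 0 , pL , λ _ ()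
least-witness P P? (suc L) pL with P? 0 | least-witness (P ∘ suc) (P? ∘ suc) L pL
... | yes p0  | _              = 0 , p0 , λ _ ()
... | no ¬p0  | d , pd , below = suc d , pd , λ { zero _ → ¬p0 ; (suc ℓ) (s≤s ℓ<d) → below ℓ ℓ<d }

-- Whether some bijection relates every point to its image is decidable: choose the
-- image of zero, then look for a bijection between the remaining points.
matching? : ∀ m n (Q : Fin m → Fin n → Set) → (∀ i j → Dec (Q i j)) →
            Dec (Σ (Permutation m n) λ π → ∀ i → Q i (π ⟨$⟩ʳ i))
matching? zero    zero    Q Q? = yes (Perm.id , λ ())
matching? zero    (suc n) Q Q? = no λ (π , _) → Perm.refute (λ ()) π
matching? (suc m) zero    Q Q? = no λ (π , _) → Perm.refute (λ ()) π
matching? (suc m) (suc n) Q Q?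
  with any? (λ j → Q? zero j ×-dec
                   matching? m n (λ k l → Q (suc k) (punchIn j l)) (λ k l → Q? (suc k) (punchIn j l)))
... | yes (j , q₀ , ρ , qρ) = yes (Perm.insert zero j ρ , extend)
  where
  extend : ∀ i → Q i (Perm.insert zero j ρ ⟨$⟩ʳ i)
  extend zero    = q₀
  extend (suc k) = subst (Q (suc k)) (sym (Perm.insert-punchIn zero j ρ k)) (qρ k)
... | no ¬ext = no λ (π , qπ) → ¬ext (π ⟨$⟩ʳ zero , qπ zero , Perm.remove zero π , λ k →
        subst (Q (suc k)) (trans (sym (Perm.insert-remove zero π (suc k)))
                                 (Perm.insert-punchIn zero (π ⟨$⟩ʳ zero) (Perm.remove zero π) k))
              (qπ (suc k)))

module Colours {n : ℕ} (G : Graph n) where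
  open Graph G using (E)

  SC : ℕ → Pair G → Pair G → Set
  SC = SameColour G

  SC-atomic : ∀ r {p q} → SC r p q → SC 0 p q
  SC-atomic zero    s = s
  SC-atomic (suc r) s = SC-atomic r (proj₁ s)

  SC-refl : ∀ r p → SC r p p
  SC-refl zero    (a , b) = mk⇔ (λ x → x) (λ x → x) , refl
  SC-refl (suc r) (a , b) = SC-refl r (a , b) , Perm.id , λ w → SC-refl r (w , b) , SC-refl r (a , w)

  SC-sym : ∀ r {p q} → SC r p q → SC r q p
  SC-sym zero    (e , adj) = mk⇔ (Equivalence.from e) (Equivalence.to e) , sym adj
  SC-sym (suc r) {a , b} {c , d} (s , π , f) = SC-sym r s , Perm.flip π , back
    where
    back : ∀ w → SC r (w , d) (π ⟨$⟩ˡ w , b) × SC r (c , w) (a , π ⟨$⟩ˡ w)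
    back w with f (π ⟨$⟩ˡ w)
    ... | s₁ , s₂ rewrite Perm.inverseʳ π {w} = SC-sym r s₁ , SC-sym r s₂

  SC-trans : ∀ r {p q s} → SC r p q → SC r q s → SC r p s
  SC-trans zero    (e , adj) (e′ , adj′) =
    mk⇔ (Equivalence.to e′ ∘ Equivalence.to e) (Equivalence.from e ∘ Equivalence.from e′) , trans adj adj′
  SC-trans (suc r) (s , π , f) (s′ , ρ , g) =
    SC-trans r s s′ , π ∘ₚ ρ , λ w → SC-trans r (proj₁ (f w)) (proj₁ (g (π ⟨$⟩ʳ w))) ,
                                    SC-trans r (proj₂ (f w)) (proj₂ (g (π ⟨$⟩ʳ w)))

  -- Colour agreement is decidable; this is what lets us count colour classes.
  SC? : ∀ r p q → Dec (SC r p q)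
  SC? zero    (a , b) (c , d) = iff? (a ≟ᶠ b) (c ≟ᶠ d) ×-dec (E a b Bool.≟ E c d)
    where
    iff? : {A B : Set} → Dec A → Dec B → Dec (A ⇔ B)
    iff? (yes a) (yes b) = yes (mk⇔ (λ _ → b) (λ _ → a))
    iff? (yes a) (no ¬b) = no λ e → ¬b (Equivalence.to e a)
    iff? (no ¬a) (yes b) = no λ e → ¬a (Equivalence.from e b)
    iff? (no ¬a) (no ¬b) = yes (mk⇔ (⊥-elim ∘ ¬a) (⊥-elim ∘ ¬b))
  SC? (suc r) (a , b) (c , d) = SC? r _ _ ×-dec
    matching? n n (λ w w′ → SC r (w , b) (w′ , d) × SC r (a , w) (c , w′)) (λ _ _ → SC? r _ _ ×-dec SC? r _ _)

  NotFiner-suc : ∀ {r} → NotFiner G r → NotFiner G (suc r)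
  NotFiner-suc nf p q (s , π , f) = (s , π , f) , π , λ w → nf _ _ (proj₁ (f w)) , nf _ _ (proj₂ (f w))

  SC-lift : ∀ {R} → NotFiner G R → ∀ k {p q} → SC R p q → SC (k + R) p q
  SC-lift nf zero    s = s
  SC-lift nf (suc k) s = stays k _ _ (SC-lift nf k s)
    where
    stays : ∀ k → NotFiner G (k + _)
    stays zero    = nf
    stays (suc k) = NotFiner-suc (stays k)

  stable-unique : ∀ {r r′} → StableRound G r → StableRound G r′ → r ≡ r′
  stable-unique {r} {r′} (nf , least) (nf′ , least′) with <-cmp r r′
  ... | tri< r<r′ _ _ = ⊥-elim (least′ r r<r′ nf)
  ... | tri≈ _ r≡r′ _ = r≡r′
  ... | tri> _ _ r′<r = ⊥-elim (least r′ r′<r nf′)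

module Distances {n : ℕ} (G : Graph n) (conn : Connected G) where
  open Graph G using (E) renaming (sym to E-sym)
  open Colours G

  walk-transport : ∀ ℓ r {x y x′ y′} → SC (ℓ + r) (x , y) (x′ , y′) →
                   Walk G ℓ x y → Walk G ℓ x′ y′
  walk-transport zero    r {x′ = x′} s nil =
    subst (Walk G 0 x′) (Equivalence.to (proj₁ (SC-atomic r s)) refl) nil
  walk-transport (suc ℓ) r (_ , π , f) (cons {y = w} x~w rest) =
    cons (trans (sym (proj₂ (SC-atomic (ℓ + r) (proj₂ (f w))))) x~w) (walk-transport ℓ r (proj₁ (f w)) rest)

  walk? : ∀ ℓ x y → Dec (Walk G ℓ x y)
  walk? zero x y with x ≟ᶠ y
  ... | yes refl = yes nil
  ... | no x≢y   = no λ { nil → x≢y refl }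
  walk? (suc ℓ) x y with any? (λ w → (E x w Bool.≟ true) ×-dec walk? ℓ w y)
  ... | yes (w , x~w , rest) = yes (cons x~w rest)
  ... | no ¬walk             = no λ { (cons {y = w} x~w rest) → ¬walk (w , x~w , rest) }

  path⇒walk : ∀ {P x y} → PathIn G P x y → Σ ℕ λ ℓ → Walk G ℓ x y
  path⇒walk (here _)       = 0 , nil
  path⇒walk (step _ x~y p) = let ℓ , w = path⇒walk p in suc ℓ , cons x~y w

  dist-exists : ∀ x y → Σ ℕ (Dist G x y)
  dist-exists x y = let L , w = path⇒walk (conn x y) in
    least-witness (λ ℓ → Walk G ℓ x y) (λ ℓ → walk? ℓ x y) L w

  dist : Fin n → Fin n → ℕ
  dist x y = proj₁ (dist-exists x y)

  shortest : ∀ x y → Walk G (dist x y) x y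
  shortest x y = proj₁ (proj₂ (dist-exists x y))

  dist-≤ : ∀ {ℓ x y} → Walk G ℓ x y → dist x y ≤ ℓ
  dist-≤ {ℓ} {x} {y} w = ≮⇒≥ λ ℓ<d → proj₂ (proj₂ (dist-exists x y)) ℓ ℓ<d w

  dist-correct : ∀ {x y d} → Dist G x y d → dist x y ≡ d
  dist-correct (w , minimal) = ≤-antisym (dist-≤ w) (≮⇒≥ λ d′<d → minimal _ d′<d (shortest _ _))

  snoc : ∀ {ℓ x y z} → Walk G ℓ x y → Adj G y z → Walk G (suc ℓ) x z
  snoc nil          y~z = cons y~z nil
  snoc (cons x~w w) y~z = cons x~w (snoc w y~z)

  reverse : ∀ {ℓ x y} → Walk G ℓ x y → Walk G ℓ y x
  reverse nil                             = nil
  reverse (cons {x = x} {y = w} x~w rest) = snoc (reverse rest) (trans (E-sym w x) x~w)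

  _++ʷ_ : ∀ {ℓ m x y z} → Walk G ℓ x y → Walk G m y z → Walk G (ℓ + m) x z
  nil        ++ʷ w′ = w′
  cons x~w w ++ʷ w′ = cons x~w (w ++ʷ w′)

  dist-sym : ∀ x y → dist x y ≡ dist y x
  dist-sym x y = ≤-antisym (dist-≤ (reverse (shortest y x))) (dist-≤ (reverse (shortest x y)))

  dist-triangle : ∀ x y z → dist x z ≤ dist x y + dist y z
  dist-triangle x y z = dist-≤ (shortest x y ++ʷ shortest y z)

  dist-step : ∀ x {y z} → Adj G y z → dist x z ≤ suc (dist x y)
  dist-step x {y} y~z = dist-≤ (snoc (shortest x y) y~z)

  dist-invariant : ∀ {R} → NotFiner G R → ∀ {x y x′ y′} →
                   SC R (x , y) (x′ , y′) → dist x y ≡ dist x′ y′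
  dist-invariant {R} nf {x} {y} {x′} {y′} s = ≤-antisym
    (dist-≤ (walk-transport _ R (SC-lift nf _ (SC-sym R s)) (shortest x′ y′)))
    (dist-≤ (walk-transport _ R (SC-lift nf _ s) (shortest x y)))

  profile : (ℕ → ℕ → ℕ) → Fin n → Fin n → ℕ
  profile h y z = sum λ x → h (dist x y) (dist x z)

  nearer : Fin n → Fin n → ℕ
  nearer = profile λ a b → 𝟙 (a <? b)

  -- Distance profiles are invariants of the stable colouring: the permutation
  -- witnessing the colour agreement carries one profile onto the other.
  profile-invariant : ∀ {R} → NotFiner G R → ∀ h {y z y′ z′} →
                      SC R (y , z) (y′ , z′) → profile h y z ≡ profile h y′ z′
  profile-invariant {R} nf h {y} {z} {y′} {z′} s with nf _ _ s
  ... | _ , π , f = trans (sum-cong-≗ λ x → cong₂ h (dist-at-y x) (dist-invariant nf (proj₁ (f x))))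
                          (sym (sum-permute (λ x → h (dist x y′) (dist x z′)) π))
    where
    dist-at-y : ∀ x → dist x y ≡ dist (π ⟨$⟩ʳ x) y′
    dist-at-y x = trans (dist-sym x y) (trans (dist-invariant nf (proj₂ (f x))) (dist-sym y′ _))

module ColourClass {n : ℕ} (G : Graph n) {R : ℕ} (nf : NotFiner G R)
                   (homogeneous : ∀ y z → SameColour G R (y , y) (z , z)) (p : Pair G) where
  open Colours G

  arc : Fin n → Fin n → ℕ
  arc y z = 𝟙 (SC? R (y , z) p)

  outdeg indeg : Fin n → ℕ
  outdeg y = sum λ z → arc y z
  indeg  z = sum λ y → arc y z

  -- Every vertex has the same out-degree (resp. in-degree) in the class, because
  -- the colour agreement of (y , y) and (z , z) matches the arcs at y and at z.
  outdeg-regular : ∀ y z → outdeg y ≡ outdeg z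
  outdeg-regular y z with nf _ _ (homogeneous y z)
  ... | _ , π , f = trans (sum-cong-≗ {n} λ w → 𝟙-cong (SC-trans R (SC-sym R (proj₂ (f w))))
                                                  (SC-trans R (proj₂ (f w))) (SC? R (y , w) p) (SC? R (z , π ⟨$⟩ʳ w) p))
                          (sym (sum-permute (λ w → arc z w) π))

  indeg-regular : ∀ y z → indeg y ≡ indeg z
  indeg-regular y z with nf _ _ (homogeneous y z)
  ... | _ , π , f = trans (sum-cong-≗ {n} λ w → 𝟙-cong (SC-trans R (SC-sym R (proj₁ (f w))))
                                                  (SC-trans R (proj₁ (f w))) (SC? R (w , y) p) (SC? R (π ⟨$⟩ʳ w , z) p))
                          (sym (sum-permute (λ w → arc w z) π))

  -- Counting all arcs by sources and by targets shows in- and out-degrees agree.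
  outdeg≡indeg : ∀ y → outdeg y ≡ indeg y
  outdeg≡indeg y = *-cancelˡ-≡ _ _ n {{>-nonZero (vertex⇒0<n y)}} (begin
    n * outdeg y              ≡⟨ sym (sum-const n (outdeg y)) ⟩
    sum {n} (λ w → outdeg y)  ≡⟨ sum-cong-≗ {n} (λ w → outdeg-regular y w) ⟩
    sum {n} (λ w → outdeg w)  ≡⟨ ∑-comm {n} {n} arc ⟩
    sum {n} (λ w → indeg w)   ≡⟨ sum-cong-≗ {n} (λ w → indeg-regular w y) ⟩
    sum {n} (λ w → indeg y)   ≡⟨ sum-const n (indeg y) ⟩
    n * indeg y               ∎)
    where
    open ≡-Reasoning
    vertex⇒0<n : ∀ {m} → Fin m → 0 < m
    vertex⇒0<n zero    = s≤s z≤n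
    vertex⇒0<n (suc _) = s≤s z≤n

  classSum : (Fin n → Fin n → ℕ) → ℕ
  classSum g = sum λ y → sum λ z → arc y z * g y z

  classSum-+ : ∀ g h → classSum (λ y z → g y z + h y z) ≡ classSum g + classSum h
  classSum-+ g h = trans (sum-cong-≗ {n} λ y → trans (sum-cong-≗ {n} λ z → *-distribˡ-+ (arc y z) (g y z) (h y z))
                                                 (∑-distrib-+ {n} _ _))
                         (∑-distrib-+ {n} _ _)

  classSum-cong : ∀ {g h} → (∀ {y z} → SC R (y , z) p → g y z ≡ h y z) → classSum g ≡ classSum h
  classSum-cong g≡h = sum-cong-≗ {n} λ y → sum-cong-≗ {n} λ z → 𝟙-*-cong (SC? R (y , z) p) g≡h

  classSum-swap : (g : Fin n → Fin n → Fin n → ℕ) →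
                  sum (λ x → classSum (g x)) ≡ classSum (λ y z → sum λ x → g x y z)
  classSum-swap g = trans (∑-comm (λ x y → sum λ z → arc y z * g x y z))
    (sum-cong-≗ {n} λ y → trans (∑-comm (λ x z → arc y z * g x y z))
      (sum-cong-≗ {n} λ z → sym (*-distribˡ-sum (arc y z) (λ x → g x y z))))

  -- A weight depending only on sources has the same class sum as when it is
  -- evaluated at targets, because in- and out-degrees agree.
  classSum-source≡target : (f : Fin n → ℕ) → classSum (λ y _ → f y) ≡ classSum (λ _ z → f z)
  classSum-source≡target f = begin
    sum (λ y → sum λ z → arc y z * f y) ≡⟨ sum-cong-≗ {n} (λ y → sym (*-distribʳ-sum (f y) (arc y))) ⟩
    sum (λ y → outdeg y * f y)          ≡⟨ sum-cong-≗ {n} (λ y → cong (_* f y) (outdeg≡indeg y)) ⟩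
    sum (λ z → indeg z * f z)           ≡⟨ sum-cong-≗ {n} (λ z → *-distribʳ-sum (f z) (λ y → arc y z)) ⟩
    sum (λ z → sum λ y → arc y z * f z) ≡⟨ ∑-comm (λ z y → arc y z * f z) ⟩
    sum (λ y → sum λ z → arc y z * f z) ∎
    where open ≡-Reasoning

  classSize : ℕ
  classSize = classSum (λ _ _ → 1)

  classSum-invariant : ∀ g → (∀ {y z} → SC R (y , z) p → g y z ≡ g (proj₁ p) (proj₂ p)) →
                       classSum g ≡ classSize * g (proj₁ p) (proj₂ p)
  classSum-invariant g inv = begin
    classSum g                            ≡⟨ classSum-cong inv ⟩
    sum (λ y → sum λ z → arc y z * g₀)    ≡⟨ sum-cong-≗ {n} (λ y → sym (*-distribʳ-sum g₀ (arc y))) ⟩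
    sum (λ y → sum (λ z → arc y z) * g₀)  ≡⟨ sym (*-distribʳ-sum g₀ (λ y → sum (arc y))) ⟩
    sum (λ y → sum λ z → arc y z) * g₀    ≡⟨ cong (_* g₀) (sum-cong-≗ {n} λ y → sum-cong-≗ {n} λ z → sym (*-identityʳ _)) ⟩
    classSize * g₀                        ∎
    where
    open ≡-Reasoning
    g₀ : ℕ
    g₀ = g (proj₁ p) (proj₂ p)

  classSize-positive : 0 < classSize
  classSize-positive = begin
    1                                ≡⟨ sym (trans (*-identityʳ _) (𝟙-true (SC? R p p) (SC-refl R p))) ⟩
    arc (proj₁ p) (proj₂ p) * 1      ≤⟨ term≤sum (λ z → arc (proj₁ p) z * 1) (proj₂ p) ⟩
    sum (λ z → arc (proj₁ p) z * 1)  ≤⟨ term≤sum (λ y → sum λ z → arc y z * 1) (proj₁ p) ⟩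
    classSize                        ∎
    where open ≤-Reasoning

module Nearness {n : ℕ} (G : Graph n) (conn : Connected G) where
  open Colours G
  open Distances G conn

  nearer-disjoint : ∀ y z → nearer y z + nearer z y ≤ n
  nearer-disjoint y z = begin
    nearer y z + nearer z y
      ≡⟨ sym (∑-distrib-+ {n} _ _) ⟩
    sum {n} (λ x → 𝟙 (dist x y <? dist x z) + 𝟙 (dist x z <? dist x y))
      ≤⟨ sum-mono {n} (λ x → 𝟙<-exclusive (dist x y) (dist x z)) ⟩
    sum {n} (λ _ → 1)
      ≡⟨ trans (sum-const n 1) (*-identityʳ n) ⟩
    n ∎
    where open ≤-Reasoning

  -- For each x, the arcs
  -- (y , z) of the colour class of (v , u) have adjacent endpoints, and the sums
  -- of dist x y and dist x z over the class agree; hence as many arcs have x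
  -- nearer to the source as to the target.  Summing over x turns both counts
  -- into class-size multiples of the invariants nearer v u and nearer u v.
  nearer-balanced : ∀ {R} → NotFiner G R → (∀ y z → SC R (y , y) (z , z)) →
                    ∀ {v u} → Adj G v u → nearer u v ≡ nearer v u
  nearer-balanced {R} nf homogeneous {v} {u} v~u =
    *-cancelˡ-≡ _ _ classSize {{>-nonZero classSize-positive}} (begin
      classSize * nearer u v
        ≡⟨ sym (classSum-invariant (λ y z → nearer z y) (profile-invariant nf (λ a b → 𝟙 (b <? a)))) ⟩
      classSum (λ y z → nearer z y)
        ≡⟨ sym (classSum-swap towardTarget) ⟩
      sum (λ x → classSum (towardTarget x))
        ≡⟨ sum-cong-≗ {n} (λ x → sym (balanced-at x)) ⟩
      sum (λ x → classSum (towardSource x))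
        ≡⟨ classSum-swap towardSource ⟩
      classSum (λ y z → nearer y z)
        ≡⟨ classSum-invariant nearer (profile-invariant nf (λ a b → 𝟙 (a <? b))) ⟩
      classSize * nearer v u ∎)
    where
    open ColourClass G nf homogeneous (v , u)
    open ≡-Reasoning

    towardSource towardTarget : Fin n → Fin n → Fin n → ℕ
    towardSource x y z = 𝟙 (dist x y <? dist x z)
    towardTarget x y z = 𝟙 (dist x z <? dist x y)

    arc-adjacent : ∀ {y z} → SC R (y , z) (v , u) → Adj G y z
    arc-adjacent s = trans (proj₂ (SC-atomic R s)) v~u

    arc-level : ∀ x {y z} → SC R (y , z) (v , u) →
                dist x y + towardSource x y z ≡ dist x z + towardTarget x y z
    arc-level x {y} {z} s = 𝟙<-level (dist x y) (dist x z)
      (dist-step x (trans (Graph.sym G z y) (arc-adjacent s))) (dist-step x (arc-adjacent s))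

    balanced-at : ∀ x → classSum (towardSource x) ≡ classSum (towardTarget x)
    balanced-at x = +-cancelˡ-≡ (classSum (λ y _ → dist x y)) _ _ (begin
      classSum (λ y _ → dist x y) + classSum (towardSource x)   ≡⟨ sym (classSum-+ _ _) ⟩
      classSum (λ y z → dist x y + towardSource x y z)          ≡⟨ classSum-cong (arc-level x) ⟩
      classSum (λ y z → dist x z + towardTarget x y z)          ≡⟨ classSum-+ _ _ ⟩
      classSum (λ _ z → dist x z) + classSum (towardTarget x)   ≡⟨ cong (_+ classSum (towardTarget x))
                                                                     (sym (classSum-source≡target (dist x))) ⟩
      classSum (λ y _ → dist x y) + classSum (towardTarget x)   ∎)

module Separation {n : ℕ} (G : Graph n) (conn : Connected G) {S C : Subset n}
                  (component : IsComponentOf G S C) where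
  open Distances G conn

  avoids-S : ∀ x → x ∈ C → x ∉ S
  avoids-S = proj₁ (proj₂ component)

  closed : ∀ x y → x ∈ C → PathIn G (Outside G S) x y → y ∈ C
  closed = proj₂ (proj₂ (proj₂ component))

  exit-point : ∀ {L y x} → y ∈ C → x ∉ C → Walk G L y x →
               Σ (Fin n) λ s → s ∈ S × dist y s + dist s x ≤ L
  exit-point y∈C x∉C nil = ⊥-elim (x∉C y∈C)
  exit-point {suc L} {y} {x} y∈C x∉C (cons {y = w} y~w rest) with w ∈? S
  ... | yes w∈S = w , w∈S , +-mono-≤ (dist-≤ (cons y~w nil)) (dist-≤ rest)
  ... | no w∉S with exit-point (closed y w y∈C (step (avoids-S y y∈C) y~w (here w∉S))) x∉C rest
  ... | s , s∈S , bound = s , s∈S , (begin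
    dist y s + dist s x             ≤⟨ +-monoˡ-≤ (dist s x) (dist-triangle y w s) ⟩
    dist y w + dist w s + dist s x  ≤⟨ +-monoˡ-≤ (dist s x) (+-monoˡ-≤ (dist w s) (dist-≤ (cons y~w nil))) ⟩
    suc (dist w s + dist s x)       ≤⟨ s≤s bound ⟩
    suc L                           ∎)
    where open ≤-Reasoning

  closer-outside : ∀ {v u} → v ∈ C → (∀ s → s ∈ S → dist u s < dist v s) →
                   ∀ x → x ∉ C → dist u x < dist v x
  closer-outside {v} {u} v∈C closer-on-S x x∉C with exit-point v∈C x∉C (shortest v x)
  ... | s , s∈S , bound = begin-strict
    dist u x            ≤⟨ dist-triangle u s x ⟩
    dist u s + dist s x <⟨ +-monoˡ-< (dist s x) (closer-on-S s s∈S) ⟩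
    dist v s + dist s x ≤⟨ bound ⟩
    dist v x            ∎
    where open ≤-Reasoning

  -- Consequently every vertex outside C is nearer to u than to v.
  nearer-covers : ∀ {v u} → v ∈ C → (∀ s → s ∈ S → dist u s < dist v s) → n ≤ nearer u v + ∣ C ∣
  nearer-covers {v} {u} v∈C closer-on-S = begin
    n                                                      ≡⟨ sym (trans (sum-const n 1) (*-identityʳ n)) ⟩
    sum {n} (λ _ → 1)                                      ≤⟨ sum-mono {n} covered ⟩
    sum {n} (λ x → 𝟙 (dist x u <? dist x v) + 𝟙 (x ∈? C)) ≡⟨ ∑-distrib-+ {n} _ _ ⟩
    nearer u v + sum (λ x → 𝟙 (x ∈? C))                    ≡⟨ cong (nearer u v +_) (sym (∣∣-count C)) ⟩
    nearer u v + ∣ C ∣                                     ∎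
    where
    open ≤-Reasoning
    covered : ∀ x → 1 ≤ 𝟙 (dist x u <? dist x v) + 𝟙 (x ∈? C)
    covered x with x ∈? C
    ... | yes _   = m≤n+m 1 _
    ... | no x∉C  = ≤-trans (≤-reflexive (sym (𝟙-true (dist x u <? dist x v) u-nearer))) (m≤m+n _ 0)
      where
      u-nearer : dist x u < dist x v
      u-nearer = subst₂ _<_ (dist-sym u x) (dist-sym v x) (closer-outside v∈C closer-on-S x x∉C)

too-small : ∀ {A c n} → A + A ≤ n → n ≤ A + c → ¬ (2 * c < n)
too-small {A} {c} {n} 2A≤n n≤A+c 2c<n = <-irrefl refl (begin-strict
  n + n               ≤⟨ +-mono-≤ n≤A+c n≤A+c ⟩
  (A + c) + (A + c)   ≡⟨ regroup A c ⟩
  (A + A) + 2 * c     <⟨ +-mono-≤-< 2A≤n 2c<n ⟩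
  n + n               ∎)
  where
  open ≤-Reasoning
  regroup : ∀ A c → (A + c) + (A + c) ≡ (A + A) + 2 * c
  regroup = solve-∀

mainTheorem15 : (n : ℕ) (G : Graph n) → Connected G →
    (∀ u v → StableSameColour G (u , u) (v , v)) →
    (w₁ w₂ : Fin n) → Is2Separator G w₁ w₂ →
    (S : Subset n) → (∀ x → x ∈ S → (x ≡ w₁) ⊎ (x ≡ w₂)) →
    (∀ x → (x ≡ w₁) ⊎ (x ≡ w₂) → x ∈ S) →
    (C : Subset n) → IsComponentOf G S C → 2 * ∣ C ∣ < n →
    (v : Fin n) → v ∈ C →
    (u : Fin n) → Adj G v u →
    (a b c d : ℕ) → Dist G u w₁ a → Dist G v w₁ b →
    Dist G u w₂ c → Dist G v w₂ d →
    ¬ (a < b × c < d)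
mainTheorem15 n G conn diagonal w₁ w₂ _ S S⊆w₁w₂ _ C component small v v∈C u v~u a b c d
              Da Db Dc Dd (a<b , c<d) with diagonal v v
... | R , stable , _ =
  too-small {nearer u v} at-most-half (nearer-covers v∈C closer-on-S) small
  where
  open Distances G conn
  open Nearness G conn
  open Separation G conn component

  homogeneous : ∀ y z → SameColour G R (y , y) (z , z)
  homogeneous y z with diagonal y z
  ... | r , stable′ , same =
    subst (λ k → SameColour G k (y , y) (z , z)) (Colours.stable-unique G stable′ stable) same

  at-most-half : nearer u v + nearer u v ≤ n
  at-most-half = subst (λ k → nearer u v + k ≤ n) (sym (nearer-balanced (proj₁ stable) homogeneous v~u))
                       (nearer-disjoint u v)

  closer-on-S : ∀ s → s ∈ S → dist u s < dist v s
  closer-on-S s s∈S with S⊆w₁w₂ s s∈S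
  ... | inj₁ refl = subst₂ _<_ (sym (dist-correct Da)) (sym (dist-correct Db)) a<b
  ... | inj₂ refl = subst₂ _<_ (sym (dist-correct Dc)) (sym (dist-correct Dd)) c<d
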